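{- Let $1\le r\le n$ be integers and $b=(b_1,\dots,b_r)\in(\mathbb{N}^*)^r$. Then $$\sum_{k=r}^{n}\ \sum_{\substack{a_1+\cdots+a_k=n\\ a_i\in\mathbb{N}^*}}(-1)^{n-k}\frac{(n-k)!}{n!\,n^{n-k}\,a_1\cdots a_k}\binom{n-r}{k-r}a_1^{b_1}\cdots a_r^{b_r} =\frac{(-1)^r(n-r)!}{n!\,n^{n-r}}\sum_{s=r}^{n}(-1)^s\binom{n}{s}\left(\sum_{\substack{a_1+\cdots+a_r=s\\ a_i\in\mathbb{N}^*}}a_1^{b_1-1}\cdots a_r^{b_r-1}\right).$$
   Context: $\mathbb{N}^*$ denotes the set of positive integers. Inner sums run over ordered tuples of positive integers with the indicated sum. -}

module Defs where

open import Data.Nat using (ℕ; zero; suc; _+_; _*_; _∸_; _^_)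
open import Data.Nat using (_!)
open import Data.Nat.Combinatorics using (_C_)
open import Data.Integer using (+_)
open import Data.Rational using (ℚ; 0ℚ; 1ℚ; _/_; -_) renaming (_+_ to _+ℚ_; _*_ to _*ℚ_)
open import Data.List using (List; []; _∷_; [_]; map; concatMap; upTo; foldr; zipWith)
open import Data.Nat.ListAction using (product)

ℕ→ℚ : ℕ → ℚ
ℕ→ℚ m = (+ m) / 1

-- reciprocal of a natural number (only ever applied to positive numbers;
-- the value at 0 is an irrelevant convention)
inv : ℕ → ℚ
inv zero    = 0ℚ
inv (suc m) = (+ 1) / suc m

sign : ℕ → ℚ
sign zero    = 1ℚ
sign (suc m) = - sign m

Σℚ : List ℚ → ℚ
Σℚ = foldr _+ℚ_ 0ℚ

range : ℕ → ℕ → List ℕ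
range lo hi = map (λ i → lo + i) (upTo (suc (hi ∸ lo)))

comps : ℕ → ℕ → List (List ℕ)
comps zero    zero    = [ [] ]
comps zero    (suc _) = []
comps (suc k) m       =
  concatMap (λ a → map (a ∷_) (comps k (m ∸ a))) (map suc (upTo m))

-- a₁^{b₁} ⋯ a_r^{b_r}, using the first r entries of a (r = length b)
powProd : List ℕ → List ℕ → ℕ
powProd a b = product (zipWith _^_ a b)

powProd₁ : List ℕ → List ℕ → ℕ
powProd₁ a b = product (zipWith (λ x e → x ^ (e ∸ 1)) a b)

LHS : (n r : ℕ) → List ℕ → ℚ
LHS n r b = Σℚ (map (λ k → Σℚ (map (λ a →
    sign (n ∸ k) *ℚ ℕ→ℚ ((n ∸ k) !) *ℚ inv ((n !) * (n ^ (n ∸ k)) * product a)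
      *ℚ ℕ→ℚ ((n ∸ r) C (k ∸ r)) *ℚ ℕ→ℚ (powProd a b))
  (comps k n))) (range r n))

RHS : (n r : ℕ) → List ℕ → ℚ
RHS n r b =
  sign r *ℚ ℕ→ℚ ((n ∸ r) !) *ℚ inv ((n !) * (n ^ (n ∸ r)))
    *ℚ Σℚ (map (λ s → sign s *ℚ ℕ→ℚ (n C s)
                  *ℚ Σℚ (map (λ a → ℕ→ℚ (powProd₁ a b)) (comps r s)))
               (range r n))

-- Let Λ₁ = Σ_{a ≥ 1} xᵃ/a = log (1 - x)⁻¹ and Λ_k = Λ₁ᵏ, so that Σ 1/(a₁⋯a_k) over the
-- compositions of m into k parts is the coefficient of xᵐ in Λ_k. Splitting a composition into
-- its first r parts and the rest turns the inner sum for k = r + j into the coefficient of xⁿ in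
-- P_b Λ_j, where P_b is the generating series of Σ a₁^{b₁-1}⋯a_r^{b_r-1}. Up to a factor
-- independent of j, the outer coefficients are (-n)ʲ/j!, so the left side is a multiple of the
-- coefficient of xⁿ in P_b exp (-n Λ₁) = P_b (1 - x)ⁿ; binomial symmetry and a sign count turn
-- this into the right side. The identity exp (-n Λ₁) = (1 - x)ⁿ is checked coefficientwise:
-- both series solve (1 - x) f′ = -n f with f(0) = 1.
module Submission where

open import Defs
open import Function using (_∘_)
open import Data.Nat as ℕ using (ℕ; zero; suc; _∸_; _^_; _!; _≤_; _<_; z≤n; s≤s; NonZero)
import Data.Nat.Properties as ℕ
open import Data.Nat.Combinatorics using (_C_; nCk≡n!/k![n-k]!; k![n∸k]!∣n!; k>n⇒nCk≡0; nCk+nC[k+1]≡[n+1]C[k+1]; nCk≡nC[n∸k])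
open import Data.Nat.Tactic.RingSolver using (solve-∀)
open import Data.Nat.DivMod using (m*[n/m]≡n)
import Data.Integer as ℤ
import Data.Integer.Properties as ℤ
open import Data.Nat.Coprimality using (1-coprimeTo) renaming (sym to Coprime-sym)
open import Data.Rational using (ℚ; mkℚ; 0ℚ; 1ℚ; _+_; _*_; -_)
open import Data.Rational.Properties
open import Data.Rational.Solver using (module +-*-Solver)
open import Data.List using (List; []; _∷_; map; concatMap; upTo; applyUpTo; _++_)
open import Data.List.Properties using (zipWith-zeroʳ; map-∘; map-++; map-cong)
open import Data.Nat.ListAction using (product)
open import Data.Vec using (Vec; []; _∷_; toList)
open import Data.Vec.Relation.Unary.All using (All; []; _∷_)
open import Relation.Binary.PropositionalEquality
open import Relation.Nullary using (yes; no)
open +-*-Solver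
open import Data.Sum using (inj₁; inj₂)
open ≡-Reasoning

mkℚ[m/1] : ℕ → ℚ
mkℚ[m/1] m = mkℚ (ℤ.+ m) 0 (Coprime-sym (1-coprimeTo m))

ℕ→ℚ≡mkℚ : ∀ m → ℕ→ℚ m ≡ mkℚ[m/1] m
ℕ→ℚ≡mkℚ m = normalize-coprime (Coprime-sym (1-coprimeTo m))

ℕ→ℚ-+ : ∀ m n → ℕ→ℚ (m ℕ.+ n) ≡ ℕ→ℚ m + ℕ→ℚ n
ℕ→ℚ-+ m n = begin
  ℕ→ℚ (m ℕ.+ n)
    ≡⟨ /-cong (cong₂ ℤ._+_ (ℤ.*-identityʳ (ℤ.+ m)) (ℤ.*-identityʳ (ℤ.+ n))) refl ⟨
  mkℚ[m/1] m + mkℚ[m/1] n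
    ≡⟨ cong₂ _+_ (ℕ→ℚ≡mkℚ m) (ℕ→ℚ≡mkℚ n) ⟨
  ℕ→ℚ m + ℕ→ℚ n ∎

ℕ→ℚ-* : ∀ m n → ℕ→ℚ (m ℕ.* n) ≡ ℕ→ℚ m * ℕ→ℚ n
ℕ→ℚ-* m n = begin
  ℕ→ℚ (m ℕ.* n)             ≡⟨ /-cong (ℤ.pos-* m n) refl ⟩
  mkℚ[m/1] m * mkℚ[m/1] n ≡⟨ cong₂ _*_ (ℕ→ℚ≡mkℚ m) (ℕ→ℚ≡mkℚ n) ⟨
  ℕ→ℚ m * ℕ→ℚ n             ∎

ℕ→ℚ*inv≡1 : ∀ n .{{_ : NonZero n}} → ℕ→ℚ n * inv n ≡ 1ℚ
ℕ→ℚ*inv≡1 (suc n) rewrite ℕ→ℚ≡mkℚ (suc n) | normalize-coprime (1-coprimeTo (suc n)) =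
  *-inverseʳ (mkℚ[m/1] (suc n))

inv-* : ∀ m n → inv (m ℕ.* n) ≡ inv m * inv n
inv-* zero    n       = sym (*-zeroˡ (inv n))
inv-* (suc m) zero    rewrite ℕ.*-zeroʳ m = sym (*-zeroʳ (inv (suc m)))
inv-* (suc m) (suc n)
  rewrite normalize-coprime (1-coprimeTo (suc m))
        | normalize-coprime (1-coprimeTo (suc n)) = refl

inv*ℕ→ℚ≡1 : ∀ n .{{_ : NonZero n}} → inv n * ℕ→ℚ n ≡ 1ℚ
inv*ℕ→ℚ≡1 n = trans (*-comm (inv n) (ℕ→ℚ n)) (ℕ→ℚ*inv≡1 n)

ℕ→ℚ-*-cancelˡ : ∀ n .{{_ : NonZero n}} {p q} → ℕ→ℚ n * p ≡ ℕ→ℚ n * q → p ≡ q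
ℕ→ℚ-*-cancelˡ n {p} {q} eq = begin
  p                     ≡⟨ *-identityˡ p ⟨
  1ℚ * p                ≡⟨ cong (_* p) (inv*ℕ→ℚ≡1 n) ⟨
  inv n * ℕ→ℚ n * p     ≡⟨ *-assoc (inv n) (ℕ→ℚ n) p ⟩
  inv n * (ℕ→ℚ n * p)   ≡⟨ cong (inv n *_) eq ⟩
  inv n * (ℕ→ℚ n * q)   ≡⟨ *-assoc (inv n) (ℕ→ℚ n) q ⟨
  inv n * ℕ→ℚ n * q     ≡⟨ cong (_* q) (inv*ℕ→ℚ≡1 n) ⟩
  1ℚ * q                ≡⟨ *-identityˡ q ⟩
  q                     ∎

ℕ→ℚ-quotient : ∀ x y z .{{_ : NonZero y}} → x ℕ.* y ≡ z → ℕ→ℚ x ≡ ℕ→ℚ z * inv y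
ℕ→ℚ-quotient x y z xy≡z = begin
  ℕ→ℚ x                       ≡⟨ *-identityʳ (ℕ→ℚ x) ⟨
  ℕ→ℚ x * 1ℚ                  ≡⟨ cong (ℕ→ℚ x *_) (ℕ→ℚ*inv≡1 y) ⟨
  ℕ→ℚ x * (ℕ→ℚ y * inv y)     ≡⟨ *-assoc (ℕ→ℚ x) (ℕ→ℚ y) (inv y) ⟨
  ℕ→ℚ x * ℕ→ℚ y * inv y       ≡⟨ cong (_* inv y) (trans (cong ℕ→ℚ (sym xy≡z)) (ℕ→ℚ-* x y)) ⟨
  ℕ→ℚ z * inv y               ∎

inv-quotient : ∀ x y z .{{_ : NonZero y}} → x ℕ.* y ≡ z → inv x ≡ ℕ→ℚ y * inv z
inv-quotient x y z xy≡z = begin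
  inv x                       ≡⟨ *-identityʳ (inv x) ⟨
  inv x * 1ℚ                  ≡⟨ cong (inv x *_) (ℕ→ℚ*inv≡1 y) ⟨
  inv x * (ℕ→ℚ y * inv y)     ≡⟨ solve 3 (λ a b c → a :* (b :* c) := b :* (a :* c)) refl (inv x) (ℕ→ℚ y) (inv y) ⟩
  ℕ→ℚ y * (inv x * inv y)     ≡⟨ cong (ℕ→ℚ y *_) (trans (cong inv (sym xy≡z)) (inv-* x y)) ⟨
  ℕ→ℚ y * inv z               ∎

sign-+ : ∀ m n → sign (m ℕ.+ n) ≡ sign m * sign n
sign-+ zero    n = sym (*-identityˡ (sign n))
sign-+ (suc m) n = trans (cong -_ (sign-+ m n)) (neg-distribˡ-* (sign m) (sign n))

sign*sign≡1 : ∀ n → sign n * sign n ≡ 1ℚ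
sign*sign≡1 zero    = refl
sign*sign≡1 (suc n) = trans (solve 1 (λ x → (:- x) :* (:- x) := x :* x) refl (sign n)) (sign*sign≡1 n)

sign-∸ : ∀ {m n} → n ≤ m → sign (m ∸ n) ≡ sign m * sign n
sign-∸ {m} {n} n≤m = begin
  sign (m ∸ n)                     ≡⟨ *-identityʳ (sign (m ∸ n)) ⟨
  sign (m ∸ n) * 1ℚ                ≡⟨ cong (sign (m ∸ n) *_) (sign*sign≡1 n) ⟨
  sign (m ∸ n) * (sign n * sign n) ≡⟨ *-assoc (sign (m ∸ n)) (sign n) (sign n) ⟨
  sign (m ∸ n) * sign n * sign n   ≡⟨ cong (_* sign n) (sign-+ (m ∸ n) n) ⟨
  sign (m ∸ n ℕ.+ n) * sign n      ≡⟨ cong (λ k → sign k * sign n) (ℕ.m∸n+n≡m n≤m) ⟩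
  sign m * sign n                  ∎

k!*[n∸k]!*nCk≡n! : ∀ {n k} → k ≤ n → k ! ℕ.* (n ∸ k) ! ℕ.* (n C k) ≡ n !
k!*[n∸k]!*nCk≡n! {n} {k} k≤n =
  trans (cong (k ! ℕ.* (n ∸ k) ! ℕ.*_) (nCk≡n!/k![n-k]! k≤n)) (m*[n/m]≡n (k![n∸k]!∣n! k≤n))
  where instance _ = ℕ._!*_!≢0 k (n ∸ k)

[k+1]*[n+1]C[k+1]≡[n+1]*nCk : ∀ n k → suc k ℕ.* (suc n C suc k) ≡ suc n ℕ.* (n C k)
[k+1]*[n+1]C[k+1]≡[n+1]*nCk n k with k ℕ.≤? n
... | no  k≰n = begin
  suc k ℕ.* (suc n C suc k) ≡⟨ cong (suc k ℕ.*_) (k>n⇒nCk≡0 (s≤s k>n)) ⟩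
  suc k ℕ.* 0               ≡⟨ ℕ.*-zeroʳ (suc k) ⟩
  0                         ≡⟨ ℕ.*-zeroʳ (suc n) ⟨
  suc n ℕ.* 0               ≡⟨ cong (suc n ℕ.*_) (k>n⇒nCk≡0 k>n) ⟨
  suc n ℕ.* (n C k)         ∎
  where k>n = ℕ.≰⇒> k≰n
... | yes k≤n = ℕ.*-cancelˡ-≡ _ _ (k ! ℕ.* (n ∸ k) !) (begin
  k ! ℕ.* (n ∸ k) ! ℕ.* (suc k ℕ.* (suc n C suc k))
    ≡⟨ regroupˡ (k !) ((n ∸ k) !) (suc n C suc k) (suc k) ⟩
  suc k ! ℕ.* (suc n ∸ suc k) ! ℕ.* (suc n C suc k)
    ≡⟨ k!*[n∸k]!*nCk≡n! (s≤s k≤n) ⟩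
  suc n ℕ.* n !
    ≡⟨ cong (suc n ℕ.*_) (k!*[n∸k]!*nCk≡n! k≤n) ⟨
  suc n ℕ.* (k ! ℕ.* (n ∸ k) ! ℕ.* (n C k))
    ≡⟨ regroupʳ (k !) ((n ∸ k) !) (n C k) (suc n) ⟩
  k ! ℕ.* (n ∸ k) ! ℕ.* (suc n ℕ.* (n C k)) ∎)
  where
  instance _ = ℕ._!*_!≢0 k (n ∸ k)
  regroupˡ : ∀ a b c s → a ℕ.* b ℕ.* (s ℕ.* c) ≡ s ℕ.* a ℕ.* b ℕ.* c
  regroupˡ = solve-∀
  regroupʳ : ∀ a b c s → s ℕ.* (a ℕ.* b ℕ.* c) ≡ a ℕ.* b ℕ.* (s ℕ.* c)
  regroupʳ = solve-∀

∑< : ℕ → (ℕ → ℚ) → ℚ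
∑< zero    f = 0ℚ
∑< (suc n) f = f 0 + ∑< n (f ∘ suc)

infix 5 ∑<
syntax ∑< n (λ i → e) = ∑[ i < n ] e

∑-cong : ∀ n {f g : ℕ → ℚ} → (∀ i → i < n → f i ≡ g i) → ∑< n f ≡ ∑< n g
∑-cong zero    f≡g = refl
∑-cong (suc n) f≡g = cong₂ _+_ (f≡g 0 (s≤s z≤n)) (∑-cong n (λ i i<n → f≡g (suc i) (s≤s i<n)))

∑-zero : ∀ n {f : ℕ → ℚ} → (∀ i → i < n → f i ≡ 0ℚ) → ∑< n f ≡ 0ℚ
∑-zero zero    f≡0 = refl
∑-zero (suc n) f≡0 = cong₂ _+_ (f≡0 0 (s≤s z≤n)) (∑-zero n (λ i i<n → f≡0 (suc i) (s≤s i<n)))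

∑-+ : ∀ n (f g : ℕ → ℚ) → ∑[ i < n ] (f i + g i) ≡ ∑< n f + ∑< n g
∑-+ zero    f g = refl
∑-+ (suc n) f g = trans (cong (f 0 + g 0 +_) (∑-+ n (f ∘ suc) (g ∘ suc)))
  (solve 4 (λ a b c d → (a :+ b) :+ (c :+ d) := (a :+ c) :+ (b :+ d)) refl (f 0) (g 0) _ _)

∑-*ˡ : ∀ n c (f : ℕ → ℚ) → ∑[ i < n ] (c * f i) ≡ c * ∑< n f
∑-*ˡ zero    c f = sym (*-zeroʳ c)
∑-*ˡ (suc n) c f = trans (cong (c * f 0 +_) (∑-*ˡ n c (f ∘ suc))) (sym (*-distribˡ-+ c (f 0) _))

∑-*ʳ : ∀ n c (f : ℕ → ℚ) → ∑[ i < n ] (f i * c) ≡ ∑< n f * c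
∑-*ʳ n c f = trans (∑-cong n (λ i _ → *-comm (f i) c)) (trans (∑-*ˡ n c f) (*-comm c (∑< n f)))

∑-snoc : ∀ n (f : ℕ → ℚ) → ∑< (suc n) f ≡ ∑< n f + f n
∑-snoc zero    f = trans (+-identityʳ (f 0)) (sym (+-identityˡ (f 0)))
∑-snoc (suc n) f = trans (cong (f 0 +_) (∑-snoc n (f ∘ suc))) (sym (+-assoc (f 0) _ _))

∑-reverse : ∀ n (f : ℕ → ℚ) → ∑< n f ≡ ∑[ i < n ] f (n ∸ suc i)
∑-reverse zero    f = refl
∑-reverse (suc n) f = begin
  ∑< (suc n) f                         ≡⟨ ∑-snoc n f ⟩
  ∑< n f + f n                         ≡⟨ cong (_+ f n) (∑-reverse n f) ⟩
  (∑[ i < n ] f (n ∸ suc i)) + f n     ≡⟨ +-comm _ (f n) ⟩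
  f n + (∑[ i < n ] f (n ∸ suc i))     ∎

∑-comm : ∀ m n (f : ℕ → ℕ → ℚ) → ∑[ i < m ] ∑< n (f i) ≡ ∑[ j < n ] ∑[ i < m ] f i j
∑-comm zero    n f = sym (∑-zero n (λ _ _ → refl))
∑-comm (suc m) n f = begin
  ∑< n (f 0) + (∑[ i < m ] ∑< n (f (suc i)))       ≡⟨ cong (∑< n (f 0) +_) (∑-comm m n (f ∘ suc)) ⟩
  ∑< n (f 0) + (∑[ j < n ] ∑[ i < m ] f (suc i) j) ≡⟨ ∑-+ n (f 0) _ ⟨
  ∑[ j < n ] ∑[ i < suc m ] f i j                   ∎

∑-triangle : ∀ n (K : ℕ → ℕ → ℚ) →
  ∑[ t < suc n ] ∑[ i < suc t ] K i t ≡ ∑[ i < suc n ] ∑[ j < suc (n ∸ i) ] K i (i ℕ.+ j)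
∑-triangle zero    K = refl
∑-triangle (suc n) K = begin
  (K 0 0 + 0ℚ) + (∑[ t < suc n ] (K 0 (suc t) + (∑[ i < suc t ] K (suc i) (suc t))))
    ≡⟨ cong₂ _+_ (+-identityʳ (K 0 0)) (∑-+ (suc n) (λ t → K 0 (suc t)) (λ t → ∑[ i < suc t ] K (suc i) (suc t))) ⟩
  K 0 0 + ((∑[ t < suc n ] K 0 (suc t)) + (∑[ t < suc n ] ∑[ i < suc t ] K (suc i) (suc t)))
    ≡⟨ cong (λ x → K 0 0 + ((∑[ t < suc n ] K 0 (suc t)) + x)) (∑-triangle n (λ i t → K (suc i) (suc t))) ⟩
  K 0 0 + ((∑[ t < suc n ] K 0 (suc t)) + (∑[ i < suc n ] ∑[ j < suc (n ∸ i) ] K (suc i) (suc i ℕ.+ j)))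
    ≡⟨ +-assoc (K 0 0) _ _ ⟨
  ∑[ i < suc (suc n) ] ∑[ j < suc (suc n ∸ i) ] K i (i ℕ.+ j) ∎

∑-dropZeros : ∀ r n (f : ℕ → ℚ) → r ≤ n → (∀ i → i < r → f i ≡ 0ℚ) →
  ∑< n f ≡ ∑[ i < n ∸ r ] f (r ℕ.+ i)
∑-dropZeros zero    n       f r≤n f≡0 = refl
∑-dropZeros (suc r) (suc n) f (s≤s r≤n) f≡0 = begin
  f 0 + ∑< n (f ∘ suc)   ≡⟨ cong (_+ ∑< n (f ∘ suc)) (f≡0 0 (s≤s z≤n)) ⟩
  0ℚ + ∑< n (f ∘ suc)    ≡⟨ +-identityˡ _ ⟩
  ∑< n (f ∘ suc)         ≡⟨ ∑-dropZeros r n (f ∘ suc) r≤n (λ i i<r → f≡0 (suc i) (s≤s i<r)) ⟩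
  ∑[ i < n ∸ r ] f (suc r ℕ.+ i) ∎

Σℚ-++ : (xs ys : List ℚ) → Σℚ (xs ++ ys) ≡ Σℚ xs + Σℚ ys
Σℚ-++ []       ys = sym (+-identityˡ (Σℚ ys))
Σℚ-++ (x ∷ xs) ys = trans (cong (x +_) (Σℚ-++ xs ys)) (sym (+-assoc x _ _))

Σℚ-map-concatMap : ∀ {A B : Set} (F : B → ℚ) (h : A → List B) (xs : List A) →
  Σℚ (map F (concatMap h xs)) ≡ Σℚ (map (λ x → Σℚ (map F (h x))) xs)
Σℚ-map-concatMap F h []       = refl
Σℚ-map-concatMap F h (x ∷ xs) = begin
  Σℚ (map F (h x ++ concatMap h xs))             ≡⟨ cong Σℚ (map-++ F (h x) _) ⟩
  Σℚ (map F (h x) ++ map F (concatMap h xs))     ≡⟨ Σℚ-++ (map F (h x)) _ ⟩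
  Σℚ (map F (h x)) + Σℚ (map F (concatMap h xs)) ≡⟨ cong (Σℚ (map F (h x)) +_) (Σℚ-map-concatMap F h xs) ⟩
  Σℚ (map (λ x → Σℚ (map F (h x))) (x ∷ xs))     ∎

Σℚ-map-map : ∀ {A B : Set} (F : B → ℚ) (g : A → B) (xs : List A) →
  Σℚ (map F (map g xs)) ≡ Σℚ (map (F ∘ g) xs)
Σℚ-map-map F g xs = cong Σℚ (sym (map-∘ xs))

Σℚ-map-*ˡ : ∀ {A : Set} c (F : A → ℚ) (xs : List A) → Σℚ (map (λ x → c * F x) xs) ≡ c * Σℚ (map F xs)
Σℚ-map-*ˡ c F []       = sym (*-zeroʳ c)
Σℚ-map-*ˡ c F (x ∷ xs) = trans (cong (c * F x +_) (Σℚ-map-*ˡ c F xs)) (sym (*-distribˡ-+ c (F x) _))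

Σℚ-map-applyUpTo : (F : ℕ → ℚ) (g : ℕ → ℕ) (n : ℕ) → Σℚ (map F (applyUpTo g n)) ≡ ∑< n (F ∘ g)
Σℚ-map-applyUpTo F g zero    = refl
Σℚ-map-applyUpTo F g (suc n) = cong (F (g 0) +_) (Σℚ-map-applyUpTo F (g ∘ suc) n)

Σℚ-map-range : ∀ (F : ℕ → ℚ) r n → Σℚ (map F (range r n)) ≡ ∑[ j < suc (n ∸ r) ] F (r ℕ.+ j)
Σℚ-map-range F r n =
  trans (Σℚ-map-map F (r ℕ.+_) (upTo (suc (n ∸ r))))
    (Σℚ-map-applyUpTo (F ∘ (r ℕ.+_)) (λ i → i) (suc (n ∸ r)))

-- Power series as coefficient sequences
Series : Set
Series = ℕ → ℚ

infixl 7 _⋆_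

_⋆_ : Series → Series → Series
(f ⋆ g) n = ∑[ i < suc n ] f i * g (n ∸ i)

𝟙 : Series
𝟙 zero    = 1ℚ
𝟙 (suc _) = 0ℚ

infixr 8 _·_

_·_ : ℚ → Series → Series
(c · f) n = c * f n

-- The Euler operator x d/dx.
θ : Series → Series
θ f n = ℕ→ℚ n * f n

⋆-congˡ : ∀ {f f′ : Series} → f ≗ f′ → ∀ g → f ⋆ g ≗ f′ ⋆ g
⋆-congˡ f≗f′ g n = ∑-cong (suc n) (λ i _ → cong (_* g (n ∸ i)) (f≗f′ i))

⋆-congʳ : ∀ f {g g′ : Series} → g ≗ g′ → f ⋆ g ≗ f ⋆ g′
⋆-congʳ f g≗g′ n = ∑-cong (suc n) (λ i _ → cong (f i *_) (g≗g′ (n ∸ i)))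

⋆-comm : ∀ (f g : Series) → f ⋆ g ≗ g ⋆ f
⋆-comm f g n = trans (∑-reverse (suc n) (λ i → f i * g (n ∸ i))) (∑-cong (suc n) λ i i≤n →
  trans (cong (λ k → f (n ∸ i) * g k) (ℕ.m∸[m∸n]≡n (ℕ.≤-pred i≤n))) (*-comm (f (n ∸ i)) (g i)))

⋆-identityˡ : ∀ (g : Series) → 𝟙 ⋆ g ≗ g
⋆-identityˡ g n = begin
  1ℚ * g n + (∑[ i < n ] 0ℚ * g (n ∸ suc i)) ≡⟨ cong₂ _+_ (*-identityˡ (g n)) (∑-zero n (λ i _ → *-zeroˡ (g (n ∸ suc i)))) ⟩
  g n + 0ℚ                                   ≡⟨ +-identityʳ (g n) ⟩
  g n                                        ∎

⋆-scaleʳ : ∀ (f g : Series) c → f ⋆ (c · g) ≗ c · (f ⋆ g)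
⋆-scaleʳ f g c n = trans (∑-cong (suc n) (λ i _ → solve 3 (λ a b c → a :* (c :* b) := c :* (a :* b)) refl (f i) (g (n ∸ i)) c))
  (∑-*ˡ (suc n) c (λ i → f i * g (n ∸ i)))

⋆-assoc : ∀ (f g h : Series) → f ⋆ (g ⋆ h) ≗ (f ⋆ g) ⋆ h
⋆-assoc f g h n = begin
  ∑[ i < suc n ] (f i * (∑[ j < suc (n ∸ i) ] g j * h (n ∸ i ∸ j)))
    ≡⟨ ∑-cong (suc n) (λ i _ → ∑-*ˡ (suc (n ∸ i)) (f i) (λ j → g j * h (n ∸ i ∸ j))) ⟨
  ∑[ i < suc n ] ∑[ j < suc (n ∸ i) ] (f i * (g j * h (n ∸ i ∸ j)))
    ≡⟨ ∑-cong (suc n) (λ i _ → ∑-cong (suc (n ∸ i)) λ j _ →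
         cong₂ (λ u v → f i * (g u * h v)) (ℕ.m+n∸m≡n i j) (sym (ℕ.∸-+-assoc n i j))) ⟨
  ∑[ i < suc n ] ∑[ j < suc (n ∸ i) ] (f i * (g (i ℕ.+ j ∸ i) * h (n ∸ (i ℕ.+ j))))
    ≡⟨ ∑-triangle n (λ i t → f i * (g (t ∸ i) * h (n ∸ t))) ⟨
  ∑[ t < suc n ] ∑[ i < suc t ] (f i * (g (t ∸ i) * h (n ∸ t)))
    ≡⟨ ∑-cong (suc n) (λ t _ → trans
         (∑-cong (suc t) λ i _ → sym (*-assoc (f i) (g (t ∸ i)) (h (n ∸ t))))
         (∑-*ʳ (suc t) (h (n ∸ t)) (λ i → f i * g (t ∸ i)))) ⟩
  ∑[ t < suc n ] ((f ⋆ g) t * h (n ∸ t)) ∎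

⋆-tail : ∀ (f g : Series) n → f 0 ≡ 0ℚ → (f ⋆ g) n ≡ ∑[ i < n ] f (suc i) * g (n ∸ suc i)
⋆-tail f g n f0≡0 = begin
  f 0 * g n + rest ≡⟨ cong (λ x → x * g n + rest) f0≡0 ⟩
  0ℚ * g n + rest  ≡⟨ cong (_+ rest) (*-zeroˡ (g n)) ⟩
  0ℚ + rest        ≡⟨ +-identityˡ rest ⟩
  rest             ∎
  where rest = ∑[ i < n ] f (suc i) * g (n ∸ suc i)

θ-⋆ : ∀ (f g : Series) n → θ (f ⋆ g) n ≡ (θ f ⋆ g) n + (f ⋆ θ g) n
θ-⋆ f g n = trans (sym (∑-*ˡ (suc n) (ℕ→ℚ n) (λ i → f i * g (n ∸ i))))
  (trans (∑-cong (suc n) leibniz) (∑-+ (suc n) (λ i → θ f i * g (n ∸ i)) (λ i → f i * θ g (n ∸ i))))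
  where
  leibniz : ∀ i → i < suc n → ℕ→ℚ n * (f i * g (n ∸ i)) ≡ θ f i * g (n ∸ i) + f i * θ g (n ∸ i)
  leibniz i i≤n = begin
    ℕ→ℚ n * (f i * g (n ∸ i))
      ≡⟨ cong (λ k → ℕ→ℚ k * (f i * g (n ∸ i))) (ℕ.m+[n∸m]≡n (ℕ.≤-pred i≤n)) ⟨
    ℕ→ℚ (i ℕ.+ (n ∸ i)) * (f i * g (n ∸ i))
      ≡⟨ cong (_* (f i * g (n ∸ i))) (ℕ→ℚ-+ i (n ∸ i)) ⟩
    (ℕ→ℚ i + ℕ→ℚ (n ∸ i)) * (f i * g (n ∸ i))
      ≡⟨ solve 4 (λ a b x y → (a :+ b) :* (x :* y) := a :* x :* y :+ x :* (b :* y)) refl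
           (ℕ→ℚ i) (ℕ→ℚ (n ∸ i)) (f i) (g (n ∸ i)) ⟩
    θ f i * g (n ∸ i) + f i * θ g (n ∸ i) ∎

∑-⋆ʳ : ∀ D (c : ℕ → ℚ) (f : Series) (g : ℕ → Series) n →
  ∑[ j < D ] c j * (f ⋆ g j) n ≡ (f ⋆ (λ m → ∑[ j < D ] c j * g j m)) n
∑-⋆ʳ D c f g n = begin
  ∑[ j < D ] c j * (∑[ i < suc n ] f i * g j (n ∸ i))
    ≡⟨ ∑-cong D (λ j _ → ∑-*ˡ (suc n) (c j) (λ i → f i * g j (n ∸ i))) ⟨
  ∑[ j < D ] ∑[ i < suc n ] c j * (f i * g j (n ∸ i))
    ≡⟨ ∑-comm D (suc n) (λ j i → c j * (f i * g j (n ∸ i))) ⟩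
  ∑[ i < suc n ] ∑[ j < D ] c j * (f i * g j (n ∸ i))
    ≡⟨ ∑-cong (suc n) (λ i _ → ∑-cong D λ j _ →
         solve 3 (λ c f g → c :* (f :* g) := f :* (c :* g)) refl (c j) (f i) (g j (n ∸ i))) ⟩
  ∑[ i < suc n ] ∑[ j < D ] f i * (c j * g j (n ∸ i))
    ≡⟨ ∑-cong (suc n) (λ i _ → ∑-*ˡ D (f i) (λ j → c j * g j (n ∸ i))) ⟩
  ∑[ i < suc n ] f i * (∑[ j < D ] c j * g j (n ∸ i)) ∎

-- Compositions and the powers of log (1 - x)⁻¹
compSum : ℕ → (List ℕ → ℚ) → Series
compSum k F m = Σℚ (map F (comps k m))

compSum-cong : ∀ k m {F G : List ℕ → ℚ} → F ≗ G → compSum k F m ≡ compSum k G m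
compSum-cong k m F≗G = cong Σℚ (map-cong F≗G (comps k m))

compSum-*ˡ : ∀ k m c (F : List ℕ → ℚ) → compSum k (λ a → c * F a) m ≡ c * compSum k F m
compSum-*ˡ k m c F = Σℚ-map-*ˡ c F (comps k m)

compSum-suc : ∀ k m (F : List ℕ → ℚ) →
  compSum (suc k) F m ≡ ∑[ a < m ] compSum k (F ∘ (suc a ∷_)) (m ∸ suc a)
compSum-suc k m F = begin
  Σℚ (map F (concatMap (λ a → map (a ∷_) (comps k (m ∸ a))) (map suc (upTo m))))
    ≡⟨ Σℚ-map-concatMap F _ (map suc (upTo m)) ⟩
  Σℚ (map (λ a → Σℚ (map F (map (a ∷_) (comps k (m ∸ a))))) (map suc (upTo m)))
    ≡⟨ Σℚ-map-map _ suc (upTo m) ⟩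
  Σℚ (map (λ a → Σℚ (map F (map (suc a ∷_) (comps k (m ∸ suc a))))) (upTo m))
    ≡⟨ Σℚ-map-applyUpTo _ (λ a → a) m ⟩
  ∑[ a < m ] Σℚ (map F (map (suc a ∷_) (comps k (m ∸ suc a))))
    ≡⟨ ∑-cong m (λ a _ → Σℚ-map-map F (suc a ∷_) (comps k (m ∸ suc a))) ⟩
  ∑[ a < m ] compSum k (F ∘ (suc a ∷_)) (m ∸ suc a) ∎

compSum-vanish : ∀ k m (F : List ℕ → ℚ) → m < k → compSum k F m ≡ 0ℚ
compSum-vanish (suc k) zero    F m<k = refl
compSum-vanish (suc k) (suc m) F (s≤s m<k) = trans (compSum-suc k (suc m) F)
  (∑-zero (suc m) (λ i _ → compSum-vanish k (m ∸ i) (F ∘ (suc i ∷_)) (ℕ.≤-<-trans (ℕ.m∸n≤m m i) m<k)))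

-- inv is Λ₁; its value inv 0 = 0 is the constant term of log (1 - x)⁻¹.
Λ : ℕ → Series
Λ zero    = 𝟙
Λ (suc k) = inv ⋆ Λ k

compSum-inv∘product : ∀ k → compSum k (inv ∘ product) ≗ Λ k
compSum-inv∘product zero    zero    = refl
compSum-inv∘product zero    (suc m) = refl
compSum-inv∘product (suc k) m = begin
  compSum (suc k) (inv ∘ product) m
    ≡⟨ compSum-suc k m (inv ∘ product) ⟩
  ∑[ a < m ] compSum k (λ c → inv (suc a ℕ.* product c)) (m ∸ suc a)
    ≡⟨ ∑-cong m (λ a _ → compSum-cong k (m ∸ suc a) (λ c → inv-* (suc a) (product c))) ⟩
  ∑[ a < m ] compSum k (λ c → inv (suc a) * inv (product c)) (m ∸ suc a)
    ≡⟨ ∑-cong m (λ a _ → compSum-*ˡ k (m ∸ suc a) (inv (suc a)) (inv ∘ product)) ⟩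
  ∑[ a < m ] inv (suc a) * compSum k (inv ∘ product) (m ∸ suc a)
    ≡⟨ ∑-cong m (λ a _ → cong (inv (suc a) *_) (compSum-inv∘product k (m ∸ suc a))) ⟩
  ∑[ a < m ] inv (suc a) * Λ k (m ∸ suc a)
    ≡⟨ ⋆-tail inv (Λ k) m refl ⟨
  (inv ⋆ Λ k) m ∎

Λ-vanish : ∀ k m → m < k → Λ k m ≡ 0ℚ
Λ-vanish k m m<k = trans (sym (compSum-inv∘product k m)) (compSum-vanish k m (inv ∘ product) m<k)

x/[1-x] : Series
x/[1-x] zero    = 0ℚ
x/[1-x] (suc _) = 1ℚ

θ-inv : θ inv ≗ x/[1-x]
θ-inv zero    = refl
θ-inv (suc n) = ℕ→ℚ*inv≡1 (suc n)

x/[1-x]⋆-partialSum : ∀ (g : Series) m → (x/[1-x] ⋆ g) (suc m) ≡ ∑[ i < suc m ] g i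
x/[1-x]⋆-partialSum g m = begin
  (x/[1-x] ⋆ g) (suc m)           ≡⟨ ⋆-tail x/[1-x] g (suc m) refl ⟩
  ∑[ i < suc m ] 1ℚ * g (m ∸ i)   ≡⟨ ∑-cong (suc m) (λ i _ → *-identityˡ (g (m ∸ i))) ⟩
  ∑[ i < suc m ] g (m ∸ i)        ≡⟨ ∑-reverse (suc m) g ⟨
  ∑[ i < suc m ] g i              ∎

θ-Λ : ∀ k → θ (Λ (suc k)) ≗ ℕ→ℚ (suc k) · (x/[1-x] ⋆ Λ k)
θ-Λ k m = begin
  θ (inv ⋆ Λ k) m                                 ≡⟨ θ-⋆ inv (Λ k) m ⟩
  (θ inv ⋆ Λ k) m + (inv ⋆ θ (Λ k)) m             ≡⟨ cong₂ _+_ (⋆-congˡ θ-inv (Λ k) m) (inv⋆θΛ k) ⟩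
  x/[1-x]⋆Λk + ℕ→ℚ k * x/[1-x]⋆Λk                 ≡⟨ solve 2 (λ x c → x :+ c :* x := (con 1ℚ :+ c) :* x) refl x/[1-x]⋆Λk (ℕ→ℚ k) ⟩
  (1ℚ + ℕ→ℚ k) * x/[1-x]⋆Λk                       ≡⟨ cong (_* x/[1-x]⋆Λk) (ℕ→ℚ-+ 1 k) ⟨
  ℕ→ℚ (suc k) * x/[1-x]⋆Λk                        ∎
  where
  x/[1-x]⋆Λk = (x/[1-x] ⋆ Λ k) m
  θ𝟙≗0 : θ 𝟙 ≗ 0ℚ · 𝟙
  θ𝟙≗0 zero    = refl
  θ𝟙≗0 (suc n) = trans (*-zeroʳ (ℕ→ℚ (suc n))) (sym (*-zeroʳ 0ℚ))
  inv⋆θΛ : ∀ k → (inv ⋆ θ (Λ k)) m ≡ ℕ→ℚ k * (x/[1-x] ⋆ Λ k) m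
  inv⋆θΛ zero = begin
    (inv ⋆ θ 𝟙) m            ≡⟨ ⋆-congʳ inv θ𝟙≗0 m ⟩
    (inv ⋆ 0ℚ · 𝟙) m         ≡⟨ ⋆-scaleʳ inv 𝟙 0ℚ m ⟩
    0ℚ * (inv ⋆ 𝟙) m         ≡⟨ *-zeroˡ ((inv ⋆ 𝟙) m) ⟩
    0ℚ                       ≡⟨ *-zeroˡ ((x/[1-x] ⋆ 𝟙) m) ⟨
    0ℚ * (x/[1-x] ⋆ 𝟙) m     ∎
  inv⋆θΛ (suc k) = begin
    (inv ⋆ θ (Λ (suc k))) m                     ≡⟨ ⋆-congʳ inv (θ-Λ k) m ⟩
    (inv ⋆ ℕ→ℚ (suc k) · (x/[1-x] ⋆ Λ k)) m     ≡⟨ ⋆-scaleʳ inv (x/[1-x] ⋆ Λ k) (ℕ→ℚ (suc k)) m ⟩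
    ℕ→ℚ (suc k) * (inv ⋆ (x/[1-x] ⋆ Λ k)) m     ≡⟨ cong (ℕ→ℚ (suc k) *_) (⋆-assoc inv x/[1-x] (Λ k) m) ⟩
    ℕ→ℚ (suc k) * (inv ⋆ x/[1-x] ⋆ Λ k) m       ≡⟨ cong (ℕ→ℚ (suc k) *_) (⋆-congˡ (⋆-comm inv x/[1-x]) (Λ k) m) ⟩
    ℕ→ℚ (suc k) * (x/[1-x] ⋆ inv ⋆ Λ k) m       ≡⟨ cong (ℕ→ℚ (suc k) *_) (⋆-assoc x/[1-x] inv (Λ k) m) ⟨
    ℕ→ℚ (suc k) * (x/[1-x] ⋆ Λ (suc k)) m       ∎

-- exp (-n Λ₁) = (1 - x)ⁿ
[1-x]^_ : ℕ → Series
([1-x]^ n) m = sign m * ℕ→ℚ (n C m)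

∑[1-x]^suc≡[1-x]^ : ∀ n m → ∑[ i < suc m ] ([1-x]^ suc n) i ≡ ([1-x]^ n) m
∑[1-x]^suc≡[1-x]^ n zero    = +-identityʳ 1ℚ
∑[1-x]^suc≡[1-x]^ n (suc m) = begin
  ∑[ i < suc (suc m) ] ([1-x]^ suc n) i
    ≡⟨ ∑-snoc (suc m) ([1-x]^ suc n) ⟩
  (∑[ i < suc m ] ([1-x]^ suc n) i) + sign (suc m) * ℕ→ℚ (suc n C suc m)
    ≡⟨ cong₂ (λ a b → a + sign (suc m) * b) (∑[1-x]^suc≡[1-x]^ n m) pascal ⟩
  sign m * ℕ→ℚ (n C m) + (- sign m) * (ℕ→ℚ (n C m) + ℕ→ℚ (n C suc m))
    ≡⟨ solve 3 (λ s x y → s :* x :+ (:- s) :* (x :+ y) := (:- s) :* y) refl (sign m) (ℕ→ℚ (n C m)) (ℕ→ℚ (n C suc m)) ⟩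
  sign (suc m) * ℕ→ℚ (n C suc m) ∎
  where
  pascal : ℕ→ℚ (suc n C suc m) ≡ ℕ→ℚ (n C m) + ℕ→ℚ (n C suc m)
  pascal = trans (cong ℕ→ℚ (sym (nCk+nC[k+1]≡[n+1]C[k+1] n m))) (ℕ→ℚ-+ (n C m) (n C suc m))

-- The coefficientwise form of (1 - x) f′ = a f, in degrees ≤ D.
SolvesUpTo : ℕ → ℚ → Series → Set
SolvesUpTo D a f = ∀ m → m < D → θ f (suc m) ≡ a * (∑[ i < suc m ] f i)

solutions-agree : ∀ {D a} {f g : Series} → f 0 ≡ g 0 → SolvesUpTo D a f → SolvesUpTo D a g →
  ∀ m → m ≤ D → f m ≡ g m
solutions-agree {D} {a} {f} {g} f0≡g0 f-sol g-sol m m≤D = agreeBelow m m≤D m ℕ.≤-refl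
  where
  agreeBelow : ∀ m → m ≤ D → ∀ t → t ≤ m → f t ≡ g t
  agreeBelow zero    _   zero    _   = f0≡g0
  agreeBelow (suc m) m<D t t≤1+m with ℕ.m≤n⇒m<n∨m≡n t≤1+m
  ... | inj₁ (s≤s t≤m) = agreeBelow m (ℕ.<⇒≤ m<D) t t≤m
  ... | inj₂ refl      = ℕ→ℚ-*-cancelˡ (suc m) (begin
    θ f (suc m)                 ≡⟨ f-sol m m<D ⟩
    a * (∑[ i < suc m ] f i)    ≡⟨ cong (a *_) (∑-cong (suc m) (λ i i≤m → agreeBelow m (ℕ.<⇒≤ m<D) i (ℕ.≤-pred i≤m))) ⟩
    a * (∑[ i < suc m ] g i)    ≡⟨ g-sol m m<D ⟨
    θ g (suc m)                 ∎)

[1-x]^-solves : ∀ D n → SolvesUpTo D (- ℕ→ℚ n) ([1-x]^ n)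
[1-x]^-solves D zero    m _ = trans (cong (ℕ→ℚ (suc m) *_) (*-zeroʳ (sign (suc m))))
  (trans (*-zeroʳ (ℕ→ℚ (suc m))) (sym (*-zeroˡ (∑[ i < suc m ] ([1-x]^ 0) i))))
[1-x]^-solves D (suc n) m _ = begin
  ℕ→ℚ (suc m) * (sign (suc m) * ℕ→ℚ (suc n C suc m))
    ≡⟨ solve 3 (λ a s c → a :* (s :* c) := s :* (a :* c)) refl (ℕ→ℚ (suc m)) (sign (suc m)) (ℕ→ℚ (suc n C suc m)) ⟩
  sign (suc m) * (ℕ→ℚ (suc m) * ℕ→ℚ (suc n C suc m))
    ≡⟨ cong (sign (suc m) *_) (trans (sym (ℕ→ℚ-* (suc m) (suc n C suc m)))
         (trans (cong ℕ→ℚ ([k+1]*[n+1]C[k+1]≡[n+1]*nCk n m)) (ℕ→ℚ-* (suc n) (n C m)))) ⟩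
  (- sign m) * (ℕ→ℚ (suc n) * ℕ→ℚ (n C m))
    ≡⟨ solve 3 (λ s a c → (:- s) :* (a :* c) := (:- a) :* (s :* c)) refl (sign m) (ℕ→ℚ (suc n)) (ℕ→ℚ (n C m)) ⟩
  - ℕ→ℚ (suc n) * ([1-x]^ n) m
    ≡⟨ cong (- ℕ→ℚ (suc n) *_) (∑[1-x]^suc≡[1-x]^ n m) ⟨
  - ℕ→ℚ (suc n) * (∑[ i < suc m ] ([1-x]^ suc n) i) ∎

expCoeff : ℕ → ℕ → ℚ
expCoeff n j = sign j * ℕ→ℚ (n ^ j) * inv (j !)

-- exp (-n Λ₁) cut off after Λ_D; as Λ_j starts in degree j, it is exact up to degree D.
expΛ : ℕ → ℕ → Series
expΛ D n m = ∑[ j < suc D ] expCoeff n j * Λ j m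

expCoeff-suc : ∀ n j → expCoeff n (suc j) * ℕ→ℚ (suc j) ≡ - ℕ→ℚ n * expCoeff n j
expCoeff-suc n j = begin
  (- sign j) * ℕ→ℚ (n ℕ.* n ^ j) * inv (suc j ℕ.* j !) * ℕ→ℚ (suc j)
    ≡⟨ cong₂ (λ a b → (- sign j) * a * b * ℕ→ℚ (suc j)) (ℕ→ℚ-* n (n ^ j)) (inv-* (suc j) (j !)) ⟩
  (- sign j) * (ℕ→ℚ n * ℕ→ℚ (n ^ j)) * (inv (suc j) * inv (j !)) * ℕ→ℚ (suc j)
    ≡⟨ solve 6 (λ s a p i f j → (:- s) :* (a :* p) :* (i :* f) :* j := (:- a) :* (s :* p :* f) :* (j :* i)) refl
         (sign j) (ℕ→ℚ n) (ℕ→ℚ (n ^ j)) (inv (suc j)) (inv (j !)) (ℕ→ℚ (suc j)) ⟩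
  - ℕ→ℚ n * expCoeff n j * (ℕ→ℚ (suc j) * inv (suc j))
    ≡⟨ cong (- ℕ→ℚ n * expCoeff n j *_) (ℕ→ℚ*inv≡1 (suc j)) ⟩
  - ℕ→ℚ n * expCoeff n j * 1ℚ
    ≡⟨ *-identityʳ _ ⟩
  - ℕ→ℚ n * expCoeff n j ∎

expΛ-truncate : ∀ D n m → m ≤ D → expΛ (suc D) n m ≡ expΛ D n m
expΛ-truncate D n m m≤D = begin
  expΛ (suc D) n m
    ≡⟨ ∑-snoc (suc D) (λ j → expCoeff n j * Λ j m) ⟩
  expΛ D n m + expCoeff n (suc D) * Λ (suc D) m
    ≡⟨ cong (λ x → expΛ D n m + expCoeff n (suc D) * x) (Λ-vanish (suc D) m (s≤s m≤D)) ⟩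
  expΛ D n m + expCoeff n (suc D) * 0ℚ
    ≡⟨ cong (expΛ D n m +_) (*-zeroʳ (expCoeff n (suc D))) ⟩
  expΛ D n m + 0ℚ
    ≡⟨ +-identityʳ _ ⟩
  expΛ D n m ∎

expΛ-solves : ∀ D n → SolvesUpTo D (- ℕ→ℚ n) (expΛ D n)
expΛ-solves (suc D) n m (s≤s m≤D) = begin
  θ (expΛ (suc D) n) (suc m)
    ≡⟨ ∑-*ˡ (suc (suc D)) (ℕ→ℚ (suc m)) (λ j → expCoeff n j * Λ j (suc m)) ⟨
  ℕ→ℚ (suc m) * (expCoeff n 0 * 0ℚ) + (∑[ j < suc D ] ℕ→ℚ (suc m) * (expCoeff n (suc j) * Λ (suc j) (suc m)))
    ≡⟨ cong₂ _+_ (trans (cong (ℕ→ℚ (suc m) *_) (*-zeroʳ (expCoeff n 0))) (*-zeroʳ (ℕ→ℚ (suc m))))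
                 (∑-cong (suc D) (λ j _ → term j)) ⟩
  0ℚ + (∑[ j < suc D ] - ℕ→ℚ n * (expCoeff n j * (∑[ i < suc m ] Λ j i)))
    ≡⟨ +-identityˡ _ ⟩
  ∑[ j < suc D ] - ℕ→ℚ n * (expCoeff n j * (∑[ i < suc m ] Λ j i))
    ≡⟨ ∑-*ˡ (suc D) (- ℕ→ℚ n) (λ j → expCoeff n j * (∑[ i < suc m ] Λ j i)) ⟩
  - ℕ→ℚ n * (∑[ j < suc D ] expCoeff n j * (∑[ i < suc m ] Λ j i))
    ≡⟨ cong (- ℕ→ℚ n *_) (∑-cong (suc D) (λ j _ → ∑-*ˡ (suc m) (expCoeff n j) (Λ j))) ⟨
  - ℕ→ℚ n * (∑[ j < suc D ] ∑[ i < suc m ] expCoeff n j * Λ j i)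
    ≡⟨ cong (- ℕ→ℚ n *_) (∑-comm (suc D) (suc m) (λ j i → expCoeff n j * Λ j i)) ⟩
  - ℕ→ℚ n * (∑[ i < suc m ] expΛ D n i)
    ≡⟨ cong (- ℕ→ℚ n *_) (∑-cong (suc m) (λ i i≤m → expΛ-truncate D n i (ℕ.≤-trans (ℕ.≤-pred i≤m) m≤D))) ⟨
  - ℕ→ℚ n * (∑[ i < suc m ] expΛ (suc D) n i) ∎
  where
  term : ∀ j → ℕ→ℚ (suc m) * (expCoeff n (suc j) * Λ (suc j) (suc m))
             ≡ - ℕ→ℚ n * (expCoeff n j * (∑[ i < suc m ] Λ j i))
  term j = begin
    ℕ→ℚ (suc m) * (expCoeff n (suc j) * Λ (suc j) (suc m))
      ≡⟨ solve 3 (λ a c l → a :* (c :* l) := c :* (a :* l)) refl (ℕ→ℚ (suc m)) (expCoeff n (suc j)) (Λ (suc j) (suc m)) ⟩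
    expCoeff n (suc j) * θ (Λ (suc j)) (suc m)
      ≡⟨ cong (expCoeff n (suc j) *_) (θ-Λ j (suc m)) ⟩
    expCoeff n (suc j) * (ℕ→ℚ (suc j) * (x/[1-x] ⋆ Λ j) (suc m))
      ≡⟨ *-assoc (expCoeff n (suc j)) (ℕ→ℚ (suc j)) _ ⟨
    expCoeff n (suc j) * ℕ→ℚ (suc j) * (x/[1-x] ⋆ Λ j) (suc m)
      ≡⟨ cong₂ _*_ (expCoeff-suc n j) (x/[1-x]⋆-partialSum (Λ j) m) ⟩
    - ℕ→ℚ n * expCoeff n j * (∑[ i < suc m ] Λ j i)
      ≡⟨ *-assoc (- ℕ→ℚ n) (expCoeff n j) _ ⟩
    - ℕ→ℚ n * (expCoeff n j * (∑[ i < suc m ] Λ j i)) ∎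

expΛ≡[1-x]^ : ∀ D n m → m ≤ D → expΛ D n m ≡ ([1-x]^ n) m
expΛ≡[1-x]^ D n = solutions-agree {a = - ℕ→ℚ n} constant (expΛ-solves D n) ([1-x]^-solves D n)
  where
  constant : expΛ D n 0 ≡ ([1-x]^ n) 0
  constant = begin
    expCoeff n 0 * 1ℚ + (∑[ j < D ] expCoeff n (suc j) * Λ (suc j) 0)
      ≡⟨ cong (expCoeff n 0 * 1ℚ +_) (∑-zero D λ j _ →
           trans (cong (expCoeff n (suc j) *_) (Λ-vanish (suc j) 0 (s≤s z≤n))) (*-zeroʳ (expCoeff n (suc j)))) ⟩
    1ℚ + 0ℚ ≡⟨⟩
    1ℚ * 1ℚ ∎

powWeight : ℕ → Series
powWeight e zero    = 0ℚ
powWeight e (suc a) = ℕ→ℚ (suc a ^ (e ∸ 1))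

powSum : ∀ {r} → Vec ℕ r → Series
powSum {r} b = compSum r (λ a → ℕ→ℚ (powProd₁ a (toList b)))

powSum-[] : powSum [] ≗ 𝟙
powSum-[] zero    = refl
powSum-[] (suc s) = refl

powSum-∷ : ∀ {r} e (b : Vec ℕ r) → powWeight e ⋆ powSum b ≗ powSum (e ∷ b)
powSum-∷ {r} e b s = begin
  (powWeight e ⋆ powSum b) s
    ≡⟨ ⋆-tail (powWeight e) (powSum b) s refl ⟩
  ∑[ a < s ] ℕ→ℚ (suc a ^ (e ∸ 1)) * powSum b (s ∸ suc a)
    ≡⟨ ∑-cong s (λ a _ → compSum-*ˡ r (s ∸ suc a) (ℕ→ℚ (suc a ^ (e ∸ 1))) (λ c → ℕ→ℚ (powProd₁ c (toList b)))) ⟨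
  ∑[ a < s ] compSum r (λ c → ℕ→ℚ (suc a ^ (e ∸ 1)) * ℕ→ℚ (powProd₁ c (toList b))) (s ∸ suc a)
    ≡⟨ ∑-cong s (λ a _ → compSum-cong r (s ∸ suc a) (λ c → ℕ→ℚ-* (suc a ^ (e ∸ 1)) _)) ⟨
  ∑[ a < s ] compSum r (λ c → ℕ→ℚ (powProd₁ (suc a ∷ c) (toList (e ∷ b)))) (s ∸ suc a)
    ≡⟨ compSum-suc r s (λ c → ℕ→ℚ (powProd₁ c (toList (e ∷ b)))) ⟨
  powSum (e ∷ b) s ∎

powRatio : ∀ {r} → Vec ℕ r → List ℕ → ℚ
powRatio b a = inv (product a) * ℕ→ℚ (powProd a (toList b))

powRatio-∷ : ∀ {r} e (b : Vec ℕ r) a c → powRatio (suc e ∷ b) (suc a ∷ c) ≡ powWeight (suc e) (suc a) * powRatio b c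
powRatio-∷ e b a c = begin
  inv (suc a ℕ.* product c) * ℕ→ℚ (suc a ℕ.* suc a ^ e ℕ.* powProd c (toList b))
    ≡⟨ cong₂ _*_ (inv-* (suc a) (product c))
                 (trans (ℕ→ℚ-* (suc a ℕ.* suc a ^ e) _) (cong (_* _) (ℕ→ℚ-* (suc a) (suc a ^ e)))) ⟩
  inv (suc a) * inv (product c) * (ℕ→ℚ (suc a) * ℕ→ℚ (suc a ^ e) * ℕ→ℚ (powProd c (toList b)))
    ≡⟨ solve 5 (λ i p x y q → i :* p :* (x :* y :* q) := (x :* i) :* (y :* (p :* q))) refl
         (inv (suc a)) (inv (product c)) (ℕ→ℚ (suc a)) (ℕ→ℚ (suc a ^ e)) (ℕ→ℚ (powProd c (toList b))) ⟩
  ℕ→ℚ (suc a) * inv (suc a) * (ℕ→ℚ (suc a ^ e) * powRatio b c)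
    ≡⟨ cong (_* (ℕ→ℚ (suc a ^ e) * powRatio b c)) (ℕ→ℚ*inv≡1 (suc a)) ⟩
  1ℚ * (ℕ→ℚ (suc a ^ e) * powRatio b c)
    ≡⟨ *-identityˡ _ ⟩
  powWeight (suc e) (suc a) * powRatio b c ∎

compSum-powProd : ∀ {r} (b : Vec ℕ r) → All (1 ≤_) b → ∀ j →
  compSum (r ℕ.+ j) (powRatio b) ≗ powSum b ⋆ Λ j
compSum-powProd [] [] j n = begin
  compSum j (λ a → inv (product a) * ℕ→ℚ (powProd a [])) n
    ≡⟨ compSum-cong j n (λ a → trans (cong (λ xs → inv (product a) * ℕ→ℚ (product xs)) (zipWith-zeroʳ _^_ a))
                                     (*-identityʳ (inv (product a)))) ⟩
  compSum j (inv ∘ product) n ≡⟨ compSum-inv∘product j n ⟩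
  Λ j n                       ≡⟨ ⋆-identityˡ (Λ j) n ⟨
  (𝟙 ⋆ Λ j) n                 ≡⟨ ⋆-congˡ powSum-[] (Λ j) n ⟨
  (powSum [] ⋆ Λ j) n         ∎
compSum-powProd {suc r} (suc e ∷ b) (s≤s z≤n ∷ 1≤b) j n = begin
  compSum (suc (r ℕ.+ j)) (powRatio (suc e ∷ b)) n
    ≡⟨ compSum-suc (r ℕ.+ j) n (powRatio (suc e ∷ b)) ⟩
  ∑[ a < n ] compSum (r ℕ.+ j) (powRatio (suc e ∷ b) ∘ (suc a ∷_)) (n ∸ suc a)
    ≡⟨ ∑-cong n (λ a _ → trans (compSum-cong (r ℕ.+ j) (n ∸ suc a) (powRatio-∷ e b a))
                               (compSum-*ˡ (r ℕ.+ j) (n ∸ suc a) (powWeight (suc e) (suc a)) (powRatio b))) ⟩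
  ∑[ a < n ] powWeight (suc e) (suc a) * compSum (r ℕ.+ j) (powRatio b) (n ∸ suc a)
    ≡⟨ ∑-cong n (λ a _ → cong (powWeight (suc e) (suc a) *_) (compSum-powProd b 1≤b j (n ∸ suc a))) ⟩
  ∑[ a < n ] powWeight (suc e) (suc a) * (powSum b ⋆ Λ j) (n ∸ suc a)
    ≡⟨ ⋆-tail (powWeight (suc e)) (powSum b ⋆ Λ j) n refl ⟨
  (powWeight (suc e) ⋆ (powSum b ⋆ Λ j)) n
    ≡⟨ ⋆-assoc (powWeight (suc e)) (powSum b) (Λ j) n ⟩
  (powWeight (suc e) ⋆ powSum b ⋆ Λ j) n
    ≡⟨ ⋆-congˡ (powSum-∷ (suc e) b) (Λ j) n ⟩
  (powSum (suc e ∷ b) ⋆ Λ j) n ∎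

κ : ℕ → ℕ → ℚ
κ n d = ℕ→ℚ (d !) * inv (n ! ℕ.* n ^ d)

sign*κ*C≡sign*κ*expCoeff : ∀ n .{{_ : NonZero n}} {d j} → j ≤ d →
  sign (d ∸ j) * κ n (d ∸ j) * ℕ→ℚ (d C j) ≡ sign d * κ n d * expCoeff n j
sign*κ*C≡sign*κ*expCoeff n {d} {j} j≤d = begin
  sign (d ∸ j) * (ℕ→ℚ ((d ∸ j) !) * inv (n ! ℕ.* n ^ (d ∸ j))) * ℕ→ℚ (d C j)
    ≡⟨ cong (λ x → sign (d ∸ j) * (ℕ→ℚ ((d ∸ j) !) * x) * ℕ→ℚ (d C j)) (inv-* (n !) (n ^ (d ∸ j))) ⟩
  sign (d ∸ j) * (ℕ→ℚ ((d ∸ j) !) * (inv (n !) * inv (n ^ (d ∸ j)))) * ℕ→ℚ (d C j)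
    ≡⟨ solve 5 (λ s f a b c → s :* (f :* (a :* b)) :* c := s :* (f :* c) :* a :* b) refl
         (sign (d ∸ j)) (ℕ→ℚ ((d ∸ j) !)) (inv (n !)) (inv (n ^ (d ∸ j))) (ℕ→ℚ (d C j)) ⟩
  sign (d ∸ j) * (ℕ→ℚ ((d ∸ j) !) * ℕ→ℚ (d C j)) * inv (n !) * inv (n ^ (d ∸ j))
    ≡⟨ cong (λ x → x * (ℕ→ℚ ((d ∸ j) !) * ℕ→ℚ (d C j)) * inv (n !) * inv (n ^ (d ∸ j))) (sign-∸ j≤d) ⟩
  sign d * sign j * (ℕ→ℚ ((d ∸ j) !) * ℕ→ℚ (d C j)) * inv (n !) * inv (n ^ (d ∸ j))
    ≡⟨ cong₂ (λ x y → sign d * sign j * x * inv (n !) * y) factorials powers ⟩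
  sign d * sign j * (ℕ→ℚ (d !) * inv (j !)) * inv (n !) * (ℕ→ℚ (n ^ j) * inv (n ^ d))
    ≡⟨ solve 7 (λ s t f i a p b → s :* t :* (f :* i) :* a :* (p :* b) := s :* (f :* (a :* b)) :* (t :* p :* i)) refl
         (sign d) (sign j) (ℕ→ℚ (d !)) (inv (j !)) (inv (n !)) (ℕ→ℚ (n ^ j)) (inv (n ^ d)) ⟩
  sign d * (ℕ→ℚ (d !) * (inv (n !) * inv (n ^ d))) * expCoeff n j
    ≡⟨ cong (λ x → sign d * (ℕ→ℚ (d !) * x) * expCoeff n j) (inv-* (n !) (n ^ d)) ⟨
  sign d * κ n d * expCoeff n j ∎
  where
  instance
    _ = j ℕ.!≢0
    _ = ℕ.m^n≢0 n j
  factorials : ℕ→ℚ ((d ∸ j) !) * ℕ→ℚ (d C j) ≡ ℕ→ℚ (d !) * inv (j !)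
  factorials = trans (sym (ℕ→ℚ-* ((d ∸ j) !) (d C j))) (ℕ→ℚ-quotient ((d ∸ j) ! ℕ.* (d C j)) (j !) (d !)
    (trans (ℕ.*-comm ((d ∸ j) ! ℕ.* (d C j)) (j !)) (trans (sym (ℕ.*-assoc (j !) ((d ∸ j) !) (d C j))) (k!*[n∸k]!*nCk≡n! j≤d))))
  powers : inv (n ^ (d ∸ j)) ≡ ℕ→ℚ (n ^ j) * inv (n ^ d)
  powers = inv-quotient (n ^ (d ∸ j)) (n ^ j) (n ^ d)
    (trans (sym (ℕ.^-distribˡ-+-* n (d ∸ j) j)) (cong (n ^_) (ℕ.m∸n+n≡m j≤d)))

lhsCoeff : ℕ → ℕ → ℕ → ℚ
lhsCoeff n r k = sign (n ∸ k) * κ n (n ∸ k) * ℕ→ℚ ((n ∸ r) C (k ∸ r))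

LHS-summand≡lhsCoeff*powRatio : ∀ {r} n k (b : Vec ℕ r) a →
  sign (n ∸ k) * ℕ→ℚ ((n ∸ k) !) * inv (n ! ℕ.* n ^ (n ∸ k) ℕ.* product a)
    * ℕ→ℚ ((n ∸ r) C (k ∸ r)) * ℕ→ℚ (powProd a (toList b))
  ≡ lhsCoeff n r k * powRatio b a
LHS-summand≡lhsCoeff*powRatio {r} n k b a =
  trans (cong (λ x → sign (n ∸ k) * ℕ→ℚ ((n ∸ k) !) * x * Cq * Pq) (inv-* (n ! ℕ.* n ^ (n ∸ k)) (product a)))
        (solve 6 (λ s f i j c p → s :* f :* (i :* j) :* c :* p := s :* (f :* i) :* c :* (j :* p)) refl
           (sign (n ∸ k)) (ℕ→ℚ ((n ∸ k) !)) (inv (n ! ℕ.* n ^ (n ∸ k))) (inv (product a)) Cq Pq)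
  where
  Cq = ℕ→ℚ ((n ∸ r) C (k ∸ r))
  Pq = ℕ→ℚ (powProd a (toList b))

lhsCoeff≡ : ∀ n .{{_ : NonZero n}} r j → j ≤ n ∸ r →
  lhsCoeff n r (r ℕ.+ j) ≡ sign (n ∸ r) * κ n (n ∸ r) * expCoeff n j
lhsCoeff≡ n r j j≤d =
  trans (cong₂ (λ u v → sign u * κ n u * ℕ→ℚ ((n ∸ r) C v)) (sym (ℕ.∸-+-assoc n r j)) (ℕ.m+n∸m≡n r j))
        (sign*κ*C≡sign*κ*expCoeff n j≤d)

LHS≡κ*sign*⋆expΛ : ∀ {r} n .{{_ : NonZero n}} (b : Vec ℕ r) → All (1 ≤_) b →
  LHS n r (toList b) ≡ κ n (n ∸ r) * (sign (n ∸ r) * (powSum b ⋆ expΛ (n ∸ r) n) n)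
LHS≡κ*sign*⋆expΛ {r} n b 1≤b = begin
  LHS n r (toList b)
    ≡⟨ Σℚ-map-range (λ k → compSum k (summand k) n) r n ⟩
  ∑[ j < suc d ] compSum (r ℕ.+ j) (summand (r ℕ.+ j)) n
    ≡⟨ ∑-cong (suc d) (λ j j≤d → compSum≡ j (ℕ.≤-pred j≤d)) ⟩
  ∑[ j < suc d ] K * (expCoeff n j * (powSum b ⋆ Λ j) n)
    ≡⟨ ∑-*ˡ (suc d) K (λ j → expCoeff n j * (powSum b ⋆ Λ j) n) ⟩
  K * (∑[ j < suc d ] expCoeff n j * (powSum b ⋆ Λ j) n)
    ≡⟨ cong (K *_) (∑-⋆ʳ (suc d) (expCoeff n) (powSum b) Λ n) ⟩
  K * (powSum b ⋆ expΛ d n) n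
    ≡⟨ solve 3 (λ s k x → s :* k :* x := k :* (s :* x)) refl (sign d) (κ n d) ((powSum b ⋆ expΛ d n) n) ⟩
  κ n d * (sign d * (powSum b ⋆ expΛ d n) n) ∎
  where
  d = n ∸ r
  K = sign d * κ n d
  summand : ℕ → List ℕ → ℚ
  summand k a = sign (n ∸ k) * ℕ→ℚ ((n ∸ k) !) * inv (n ! ℕ.* n ^ (n ∸ k) ℕ.* product a)
    * ℕ→ℚ ((n ∸ r) C (k ∸ r)) * ℕ→ℚ (powProd a (toList b))
  compSum≡ : ∀ j → j ≤ d → compSum (r ℕ.+ j) (summand (r ℕ.+ j)) n ≡ K * (expCoeff n j * (powSum b ⋆ Λ j) n)
  compSum≡ j j≤d = begin
    compSum (r ℕ.+ j) (summand (r ℕ.+ j)) n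
      ≡⟨ compSum-cong (r ℕ.+ j) n (LHS-summand≡lhsCoeff*powRatio n (r ℕ.+ j) b) ⟩
    compSum (r ℕ.+ j) (λ a → lhsCoeff n r (r ℕ.+ j) * powRatio b a) n
      ≡⟨ compSum-*ˡ (r ℕ.+ j) n (lhsCoeff n r (r ℕ.+ j)) (powRatio b) ⟩
    lhsCoeff n r (r ℕ.+ j) * compSum (r ℕ.+ j) (powRatio b) n
      ≡⟨ cong₂ _*_ (lhsCoeff≡ n r j j≤d) (compSum-powProd b 1≤b j n) ⟩
    K * expCoeff n j * (powSum b ⋆ Λ j) n
      ≡⟨ *-assoc K (expCoeff n j) _ ⟩
    K * (expCoeff n j * (powSum b ⋆ Λ j) n) ∎

powSum⋆expΛ≡powSum⋆[1-x]^ : ∀ {r} (b : Vec ℕ r) n → (powSum b ⋆ expΛ (n ∸ r) n) n ≡ (powSum b ⋆ [1-x]^ n) n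
powSum⋆expΛ≡powSum⋆[1-x]^ {r} b n = ∑-cong (suc n) agree
  where
  agree : ∀ s → s < suc n → powSum b s * expΛ (n ∸ r) n (n ∸ s) ≡ powSum b s * ([1-x]^ n) (n ∸ s)
  agree s _ with s ℕ.<? r
  ... | yes s<r = begin
    powSum b s * expΛ (n ∸ r) n (n ∸ s)  ≡⟨ cong (_* expΛ (n ∸ r) n (n ∸ s)) powSum≡0 ⟩
    0ℚ * expΛ (n ∸ r) n (n ∸ s)          ≡⟨ *-zeroˡ (expΛ (n ∸ r) n (n ∸ s)) ⟩
    0ℚ                                   ≡⟨ *-zeroˡ (([1-x]^ n) (n ∸ s)) ⟨
    0ℚ * ([1-x]^ n) (n ∸ s)              ≡⟨ cong (_* ([1-x]^ n) (n ∸ s)) powSum≡0 ⟨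
    powSum b s * ([1-x]^ n) (n ∸ s)      ∎
    where powSum≡0 = compSum-vanish r s (λ a → ℕ→ℚ (powProd₁ a (toList b))) s<r
  ... | no  s≮r = cong (powSum b s *_) (expΛ≡[1-x]^ (n ∸ r) n (n ∸ s) (ℕ.∸-monoʳ-≤ n (ℕ.≮⇒≥ s≮r)))

sign*⋆[1-x]^ : ∀ {r n} (f : Series) → r ≤ n →
  sign (n ∸ r) * (f ⋆ [1-x]^ n) n ≡ sign r * (∑[ s < suc n ] ([1-x]^ n) s * f s)
sign*⋆[1-x]^ {r} {n} f r≤n = begin
  sign (n ∸ r) * (f ⋆ [1-x]^ n) n
    ≡⟨ ∑-*ˡ (suc n) (sign (n ∸ r)) (λ s → f s * ([1-x]^ n) (n ∸ s)) ⟨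
  ∑[ s < suc n ] sign (n ∸ r) * (f s * ([1-x]^ n) (n ∸ s))
    ≡⟨ ∑-cong (suc n) (λ s s≤n → reflect s (ℕ.≤-pred s≤n)) ⟩
  ∑[ s < suc n ] sign r * (([1-x]^ n) s * f s)
    ≡⟨ ∑-*ˡ (suc n) (sign r) (λ s → ([1-x]^ n) s * f s) ⟩
  sign r * (∑[ s < suc n ] ([1-x]^ n) s * f s) ∎
  where
  reflect : ∀ s → s ≤ n → sign (n ∸ r) * (f s * ([1-x]^ n) (n ∸ s)) ≡ sign r * (([1-x]^ n) s * f s)
  reflect s s≤n = begin
    sign (n ∸ r) * (f s * (sign (n ∸ s) * ℕ→ℚ (n C (n ∸ s))))
      ≡⟨ cong₂ (λ x y → x * (f s * (y * ℕ→ℚ (n C (n ∸ s))))) (sign-∸ r≤n) (sign-∸ s≤n) ⟩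
    sign n * sign r * (f s * (sign n * sign s * ℕ→ℚ (n C (n ∸ s))))
      ≡⟨ cong (λ c → sign n * sign r * (f s * (sign n * sign s * ℕ→ℚ c))) (nCk≡nC[n∸k] s≤n) ⟨
    sign n * sign r * (f s * (sign n * sign s * ℕ→ℚ (n C s)))
      ≡⟨ solve 5 (λ N r s c x → N :* r :* (x :* (N :* s :* c)) := N :* N :* (r :* (s :* c :* x))) refl
           (sign n) (sign r) (sign s) (ℕ→ℚ (n C s)) (f s) ⟩
    sign n * sign n * (sign r * (([1-x]^ n) s * f s))
      ≡⟨ cong (_* (sign r * (([1-x]^ n) s * f s))) (sign*sign≡1 n) ⟩
    1ℚ * (sign r * (([1-x]^ n) s * f s))
      ≡⟨ *-identityˡ _ ⟩
    sign r * (([1-x]^ n) s * f s) ∎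

RHS≡κ*sign*∑ : ∀ {r} n (b : Vec ℕ r) → r ≤ n →
  RHS n r (toList b) ≡ κ n (n ∸ r) * (sign r * (∑[ s < suc n ] ([1-x]^ n) s * powSum b s))
RHS≡κ*sign*∑ {r} n b r≤n = begin
  sign r * ℕ→ℚ (d !) * inv (n ! ℕ.* n ^ d) * Σℚ (map G (range r n))
    ≡⟨ cong (sign r * ℕ→ℚ (d !) * inv (n ! ℕ.* n ^ d) *_) (Σℚ-map-range G r n) ⟩
  sign r * ℕ→ℚ (d !) * inv (n ! ℕ.* n ^ d) * (∑[ i < suc d ] G (r ℕ.+ i))
    ≡⟨ cong (λ m → sign r * ℕ→ℚ (d !) * inv (n ! ℕ.* n ^ d) * ∑< m (G ∘ (r ℕ.+_))) (ℕ.+-∸-assoc 1 r≤n) ⟨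
  sign r * ℕ→ℚ (d !) * inv (n ! ℕ.* n ^ d) * (∑[ i < suc n ∸ r ] G (r ℕ.+ i))
    ≡⟨ cong (sign r * ℕ→ℚ (d !) * inv (n ! ℕ.* n ^ d) *_) (∑-dropZeros r (suc n) G (ℕ.m≤n⇒m≤1+n r≤n) G-vanish) ⟨
  sign r * ℕ→ℚ (d !) * inv (n ! ℕ.* n ^ d) * ∑< (suc n) G
    ≡⟨ solve 4 (λ s f i x → s :* f :* i :* x := f :* i :* (s :* x)) refl (sign r) (ℕ→ℚ (d !)) (inv (n ! ℕ.* n ^ d)) (∑< (suc n) G) ⟩
  κ n d * (sign r * ∑< (suc n) G) ∎
  where
  d = n ∸ r
  G : Series
  G s = ([1-x]^ n) s * powSum b s
  G-vanish : ∀ s → s < r → G s ≡ 0ℚ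
  G-vanish s s<r = trans (cong (([1-x]^ n) s *_) (compSum-vanish r s (λ a → ℕ→ℚ (powProd₁ a (toList b))) s<r))
                         (*-zeroʳ (([1-x]^ n) s))

lemma2 : (r n : ℕ) → 1 ≤ r → r ≤ n → (b : Vec ℕ r) → All (1 ≤_) b →
    LHS n r (toList b) ≡ RHS n r (toList b)
lemma2 (suc _) zero _ () _ _
lemma2 r n@(suc _) _ r≤n b 1≤b = begin
  LHS n r (toList b)                                              ≡⟨ LHS≡κ*sign*⋆expΛ n b 1≤b ⟩
  κ n d * (sign d * (powSum b ⋆ expΛ d n) n)                     ≡⟨ cong (λ x → κ n d * (sign d * x)) (powSum⋆expΛ≡powSum⋆[1-x]^ b n) ⟩
  κ n d * (sign d * (powSum b ⋆ [1-x]^ n) n)                     ≡⟨ cong (κ n d *_) (sign*⋆[1-x]^ (powSum b) r≤n) ⟩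
  κ n d * (sign r * (∑[ s < suc n ] ([1-x]^ n) s * powSum b s))  ≡⟨ RHS≡κ*sign*∑ n b r≤n ⟨
  RHS n r (toList b)                                              ∎
  where d = n ∸ r
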